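{- Let $W=(N,w,\tau)$ be a TPWN and let $\sigma=t_1\dots t_n$ be a firing sequence of $W$ compatible with the earliest-first scheduler $\gamma$. Then for every $1\le i<n$ we have $\mathit{start}(t_1\dots t_i)\le\mathit{start}(t_1\dots t_it_{i+1})$.
   Context: A workflow net is $N=(P,T,F,i,o)$: $P,T$ disjoint finite sets, $F\subseteq(P\times T)\cup(T\times P)$, $i$ without incoming and $o$ without outgoing arcs, $(P\cup T,F\cup\{(o,i)\})$ strongly connected. ${}^\bullet x,x^\bullet$ pre/postsets, extended to sets by union. Markings, firing $M\xrightarrow{t}M'$, firing sequences as usual; $\mathbf{i}$ has one token in $i$ and none elsewhere. 1-safe: reachable markings have at most one token per place (identified with sets of places). Transitions are independent if their presets are disjoint, dependent otherwise; at a 1-safe marking $M$ two enabled transitions are concurrent if independent, in conflict if dependent; $C(t,M)$ = set of transitions in conflict with $t$ at $M$ (contains $t$), $\mathcal{C}(M)=\{C(t,M):t\text{ enabled at }M\}$. Confusion-free: for every reachable $M$, enabled $t$, $u$ concurrent with $t$ at $M$: $C(u,M)=C(u,M\setminus{}^\bullet t)=C(u,(M\setminus{}^\bullet t)\cup t^\bullet)$. A TPWN is $W=(N,w,\tau)$, $N$ 1-safe confusion-free, $w:T\to\mathbb{Q}_{>0}$, $\tau:T\to\mathbb{N}$. Timing: $\mathbb{N}_\bot=\{\bot\}\cup\mathbb{N}$, $\bot\le x$, $\bot+x=\bot$; $upd(\vec x,t)_p=\max_{q\in{}^\bullet t}\vec x_q+\tau(t)$ if $p\in t^\bullet$, $\bot$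 if $p\in{}^\bullet t\setminus t^\bullet$, $\vec x_p$ otherwise; $\mu(\epsilon)_i=0$, $\mu(\epsilon)_p=\bot$ ($p\ne i$), $\mu(\sigma t)=upd(\mu(\sigma),t)$. $\mathit{start}(\epsilon)=0$, $\mathit{start}(\sigma t)=\max_{q\in{}^\bullet t}\mu(\sigma)_q$. The earliest-first scheduler $\gamma$ assigns to each firing sequence $\mathbf{i}\xrightarrow{\sigma}M$ with $\mathcal{C}(M)\ne\emptyset$ a conflict set $\gamma(\sigma)\in\operatorname{argmin}_{C\in\mathcal{C}(M)}\max_{p\in{}^\bullet C}\mu(\sigma)_p$ (ties broken arbitrarily but fixed). A firing sequence $\sigma$ is compatible with $\gamma$ if for every decomposition $\sigma=\sigma_1t\sigma_2$ with $t\in T$, $t\in\gamma(\sigma_1)$. -}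

module Defs where

open import Data.Nat using (ℕ; zero; suc; _+_; _∸_; _⊔_; _≤_; _≤ᵇ_)
open import Data.Bool using (Bool; true; false; _∧_; _∨_; not; if_then_else_)
open import Data.Fin using (Fin) renaming (_≟_ to _≟ᶠ_)
open import Relation.Nullary using (yes; no)
open import Data.List using (List; []; _∷_; _++_; foldr; foldl; unsnoc)
open import Data.Bool.ListAction using (any; all)
open import Data.List using () renaming (allFin to allFinL)
open import Data.Maybe using (Maybe; just; nothing)
open import Data.Product using (Σ; ∃; _×_; _,_)
open import Data.Sum using (_⊎_; inj₁; inj₂)
open import Data.Empty using (⊥)
open import Data.Unit using (⊤)
open import Data.Rational using (ℚ; 0ℚ) renaming (_<_ to _<ℚ_)
open import Relation.Binary.PropositionalEquality using (_≡_)
open import Relation.Binary.Construct.Closure.ReflexiveTransitive using (Star)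

-- Petri nets with finite place set Fin np and transition set Fin nt.
-- pre t p = true iff (p,t) ∈ F ; post t p = true iff (t,p) ∈ F.

record Net : Set where
  field
    np   : ℕ
    nt   : ℕ
    pre  : Fin nt → Fin np → Bool
    post : Fin nt → Fin np → Bool
    iₚ   : Fin np
    oₚ   : Fin np

module _ (N : Net) where
  open Net N

  Place = Fin np
  Trans = Fin nt

  -- nodes of the net graph, with the extra arc (o,i)
  Node = Place ⊎ Trans

  ArcE : Node → Node → Set
  ArcE (inj₁ p) (inj₁ q) = (p ≡ oₚ) × (q ≡ iₚ)
  ArcE (inj₁ p) (inj₂ t) = pre t p ≡ true
  ArcE (inj₂ t) (inj₁ p) = post t p ≡ true
  ArcE (inj₂ t) (inj₂ u) = ⊥

  IsWorkflowNet : Set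
  IsWorkflowNet =
      (∀ t → post t iₚ ≡ false)
    × (∀ t → pre t oₚ ≡ false)
    × (∀ x y → Star ArcE x y)

  Marking = Place → ℕ

  initM : Marking
  initM p with p ≟ᶠ iₚ
  ... | yes _ = 1
  ... | no _  = 0

  b2n : Bool → ℕ
  b2n true  = 1
  b2n false = 0

  places : List Place
  places = allFinL np

  enabled : Marking → Trans → Bool
  enabled M t = all (λ p → not (pre t p) ∨ (1 ≤ᵇ M p)) places

  fire : Marking → Trans → Marking
  fire M t p = (M p ∸ b2n (pre t p)) + b2n (post t p)

  data Fires : Marking → List Trans → Marking → Set where
    done : ∀ {M} → Fires M [] M
    step : ∀ {M M' t σ} → enabled M t ≡ true → Fires (fire M t) σ M' → Fires M (t ∷ σ) M'

  Reachable : Marking → Set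
  Reachable M = ∃ λ σ → Fires initM σ M

  OneSafe : Set
  OneSafe = ∀ M → Reachable M → ∀ p → M p ≤ 1

  dependent : Trans → Trans → Bool
  dependent t u = any (λ p → pre t p ∧ pre u p) places

  TSet = Trans → Bool

  conflictSet : Trans → Marking → TSet
  conflictSet t M u = enabled M t ∧ enabled M u ∧ dependent t u

  _≐_ : TSet → TSet → Set
  A ≐ B = ∀ u → A u ≡ B u

  -- M \ •t  and  (M \ •t) ∪ t•   (markings read as sets)
  removePre : Marking → Trans → Marking
  removePre M t p = if pre t p then 0 else M p

  addPost : Marking → Trans → Marking
  addPost M t p = if post t p then 1 else M p

  ConfusionFree : Set
  ConfusionFree = ∀ M → Reachable M → ∀ t u →
    enabled M t ≡ true → enabled M u ≡ true → dependent t u ≡ false →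
      (conflictSet u M ≐ conflictSet u (removePre M t))
    × (conflictSet u M ≐ conflictSet u (addPost (removePre M t) t))

-- ℕ⊥ = Maybe ℕ, with ⊥ = nothing

ℕ⊥ = Maybe ℕ

data _≤⊥_ : ℕ⊥ → ℕ⊥ → Set where
  ⊥≤    : ∀ {y} → nothing ≤⊥ y
  just≤ : ∀ {m n} → m ≤ n → just m ≤⊥ just n

max⊥ : ℕ⊥ → ℕ⊥ → ℕ⊥
max⊥ nothing y = y
max⊥ (just m) nothing = just m
max⊥ (just m) (just n) = just (m ⊔ n)

_+⊥_ : ℕ⊥ → ℕ → ℕ⊥
nothing +⊥ k = nothing
just m +⊥ k = just (m + k)

maxOver : {A : Set} → List A → (A → ℕ⊥) → ℕ⊥
maxOver xs f = foldr (λ a r → max⊥ (f a) r) nothing xs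

module Timing (N : Net) (τ : Fin (Net.nt N) → ℕ) where
  open Net N

  TimeVec = Fin np → ℕ⊥

  maxPre : TimeVec → Fin nt → ℕ⊥
  maxPre x t = maxOver (places N) (λ q → if pre t q then x q else nothing)

  upd : TimeVec → Fin nt → TimeVec
  upd x t p = if post t p then maxPre x t +⊥ τ t
              else (if pre t p then nothing else x p)

  μ0 : TimeVec
  μ0 p with p ≟ᶠ iₚ
  ... | yes _ = just 0
  ... | no _  = nothing

  μ : List (Fin nt) → TimeVec
  μ σ = foldl upd μ0 σ

  start : List (Fin nt) → ℕ⊥
  start σ with unsnoc σ
  ... | nothing = just 0
  ... | just (ρ , t) = maxPre (μ ρ) t

  conflictValue : List (Fin nt) → TSet N → ℕ⊥
  conflictValue σ C =
    maxOver (places N) (λ p → if any (λ v → C v ∧ pre v p) (allFinL nt)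
                              then μ σ p else nothing)

  IsEarliestFirst : (List (Fin nt) → TSet N) → Set
  IsEarliestFirst γ = ∀ σ M → Fires N (initM N) σ M →
    (∃ λ t → enabled N M t ≡ true) →
    ∃ λ t → (enabled N M t ≡ true)
          × (_≐_ N (γ σ) (conflictSet N t M))
          × (∀ u → enabled N M u ≡ true →
               conflictValue σ (conflictSet N t M) ≤⊥ conflictValue σ (conflictSet N u M))

  Compatible : (List (Fin nt) → TSet N) → List (Fin nt) → Set
  Compatible γ σ = ∀ σ₁ t σ₂ → σ ≡ σ₁ ++ (t ∷ σ₂) → γ σ₁ t ≡ true

record TPWN : Set where
  field
    net      : Net
    w        : Fin (Net.nt net) → ℚ
    τ        : Fin (Net.nt net) → ℕ
    w-pos    : ∀ t → 0ℚ <ℚ w t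
    isWF     : IsWorkflowNet net
    oneSafe  : OneSafe net
    confFree : ConfusionFree net

module Submission where

-- If u consumes a token produced by t, it cannot start before t ends. Otherwise u was already
-- enabled when t was scheduled and t consumed none of its inputs, so the earliest-first choice
-- bounds the start of t by the value of the conflict set of u. That value is the start of u
-- itself: in every run, each input place of a transition v in conflict with u received its
-- token no later than the inputs of u. Otherwise take the last transition w of the run that
-- finishes after the inputs of u; the transitions following w finish earlier, hence consume
-- none of its outputs, and w can be postponed to the end of the run. Then u reads no output
-- of w either, so by confusion-freeness v was already in conflict with u before w fired and
-- w does not touch the inputs of v; induction on the length of the run concludes.

open import Defs
open import Data.Nat using (ℕ; suc; _≤_; _<_)
open import Data.List using (List; length; take)
open import Data.Fin using (Fin)
open import Data.Product using (∃)

open import Data.Bool using (Bool; true; false; _∧_; _∨_; not; if_then_else_)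
open import Data.Bool.ListAction using (any; all)
open import Data.Bool.Properties using (¬-not; not-¬; T-≡; ∧-zeroʳ) renaming (_≟_ to _≟ᵇ_)
open import Data.Empty using (⊥; ⊥-elim)
open import Data.Fin using () renaming (_≟_ to _≟ᶠ_)
open import Data.Fin.Properties using (any?)
open import Data.List using ([]; _∷_; _++_; foldl; unsnoc; _∷ʳ_; initLast; _∷ʳ′_)
  renaming (allFin to allFinL)
open import Data.List.Membership.Propositional using (_∈_)
open import Data.List.Membership.Propositional.Properties using (∈-allFin)
open import Data.List.Properties using (foldl-++; foldl-∷ʳ; length-++-sucʳ; ∷ʳ-injective; ++-conicalʳ)
open import Data.List.Relation.Unary.Any using (here; there)
open import Data.Maybe using (just; nothing)
open import Data.Nat using (zero; _+_; _∸_; _≤ᵇ_; z≤n; s≤s)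
open import Data.Nat.Properties
  using ( ≤-refl; ≤-trans; ≤-antisym; <-irrefl; +-monoˡ-≤; m≤m⊔n; m≤n⊔m; ⊔-lub; m≤m+n; m≤n+m
        ; +-identityʳ; ≤ᵇ⇒≤; ≤⇒≤ᵇ)
  renaming (_≤?_ to _≤ℕ?_)
open import Data.Product using (∃₂; _×_; _,_; proj₁; proj₂)
open import Data.Sum using (_⊎_; inj₁; inj₂)
open import Function.Base using (_∘_)
open import Function.Bundles using (Equivalence)
open import Relation.Binary.Bundles using (Poset)
open import Relation.Binary.Construct.Closure.ReflexiveTransitive using (Star; ε; _◅_)
open import Relation.Binary.PropositionalEquality
  using (_≡_; _≗_; refl; sym; trans; cong; subst; subst₂; isEquivalence)
open import Relation.Nullary using (¬_; Dec; yes; no; _×-dec_)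

Disjoint : {A : Set} → (A → Bool) → (A → Bool) → Set
Disjoint P Q = ∀ x → P x ≡ true → Q x ≡ false

disjoint-clash : {A : Set} {P Q : A → Bool} {x : A} → Disjoint P Q → P x ≡ true → Q x ≡ true → ⊥
disjoint-clash d px qx = not-¬ qx (d _ px)

Disjoint-sym : {A : Set} {P Q : A → Bool} → Disjoint P Q → Disjoint Q P
Disjoint-sym d x qx = ¬-not (λ px → disjoint-clash d px qx)

disjoint-or-overlap : ∀ {n} (P Q : Fin n → Bool) → Disjoint P Q ⊎ ∃ λ q → P q ≡ true × Q q ≡ true
disjoint-or-overlap P Q with any? (λ q → (P q ≟ᵇ true) ×-dec (Q q ≟ᵇ true))
... | yes common = inj₂ common
... | no ¬common = inj₁ (λ q pq → ¬-not (λ qq → ¬common (q , pq , qq)))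

true-or-false : ∀ b → b ≡ true ⊎ b ≡ false
true-or-false true = inj₁ refl
true-or-false false = inj₂ refl

∧-true⁻ : ∀ {a b} → a ∧ b ≡ true → a ≡ true × b ≡ true
∧-true⁻ {true} {true} _ = refl , refl

∧-true⁺ : ∀ {a b} → a ≡ true → b ≡ true → a ∧ b ≡ true
∧-true⁺ refl refl = refl

module _ {A : Set} (f : A → Bool) where

  all-true⁻ : ∀ xs {x} → all f xs ≡ true → x ∈ xs → f x ≡ true
  all-true⁻ (y ∷ xs) h (here refl) = proj₁ (∧-true⁻ h)
  all-true⁻ (y ∷ xs) h (there x∈xs) = all-true⁻ xs (proj₂ (∧-true⁻ {f y} h)) x∈xs

  all-true⁺ : ∀ xs → (∀ x → f x ≡ true) → all f xs ≡ true
  all-true⁺ [] h = refl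
  all-true⁺ (y ∷ xs) h = ∧-true⁺ (h y) (all-true⁺ xs h)

  any-true⁻ : ∀ xs → any f xs ≡ true → ∃ λ x → f x ≡ true
  any-true⁻ (y ∷ xs) h with f y in fy
  ... | true = y , fy
  ... | false = any-true⁻ xs h

  any-true⁺ : ∀ xs {x} → x ∈ xs → f x ≡ true → any f xs ≡ true
  any-true⁺ (y ∷ xs) (here refl) h rewrite h = refl
  any-true⁺ (y ∷ xs) (there x∈xs) h with f y
  ... | true = refl
  ... | false = any-true⁺ xs x∈xs h

  any-false⁺ : ∀ xs → (∀ x → f x ≡ false) → any f xs ≡ false
  any-false⁺ [] h = refl
  any-false⁺ (y ∷ xs) h rewrite h y = any-false⁺ xs h

all-cong : {A : Set} (f g : A → Bool) → f ≗ g → ∀ xs → all f xs ≡ all g xs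
all-cong f g f≗g [] = refl
all-cong f g f≗g (y ∷ xs) rewrite f≗g y | all-cong f g f≗g xs = refl

unsnoc-∷ʳ : {A : Set} (xs : List A) (x : A) → unsnoc (xs ∷ʳ x) ≡ just (xs , x)
unsnoc-∷ʳ xs x = go (xs ∷ʳ x) refl
  where
  go : ∀ ys → ys ≡ xs ∷ʳ x → unsnoc ys ≡ just (xs , x)
  go ys eq with initLast ys
  go .[] eq | [] with () ← ++-conicalʳ xs _ (sym eq)
  go .(zs ∷ʳ z) eq | zs ∷ʳ′ z with ∷ʳ-injective zs xs eq
  ... | refl , refl = refl

take-consecutive : {A : Set} (k : ℕ) (σ : List A) → suc k < length σ →
  ∃₂ λ ρ t → ∃₂ λ u rest →
    σ ≡ ρ ++ t ∷ u ∷ rest × take (suc k) σ ≡ ρ ∷ʳ t × take (suc (suc k)) σ ≡ ρ ∷ʳ t ∷ʳ u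
take-consecutive zero (t ∷ []) (s≤s ())
take-consecutive zero (t ∷ u ∷ rest) _ = [] , t , u , rest , refl , refl , refl
take-consecutive (suc k) (a ∷ σ) (s≤s k<σ) with take-consecutive k σ k<σ
... | ρ , t , u , rest , σ≡ , take₁ , take₂ =
  a ∷ ρ , t , u , rest , cong (a ∷_) σ≡ , cong (a ∷_) take₁ , cong (a ∷_) take₂

≤⊥-refl : ∀ {x} → x ≤⊥ x
≤⊥-refl {nothing} = ⊥≤
≤⊥-refl {just m} = just≤ ≤-refl

≤⊥-trans : ∀ {x y z} → x ≤⊥ y → y ≤⊥ z → x ≤⊥ z
≤⊥-trans ⊥≤ _ = ⊥≤
≤⊥-trans (just≤ m≤n) (just≤ n≤k) = just≤ (≤-trans m≤n n≤k)

≤⊥-reflexive : ∀ {x y} → x ≡ y → x ≤⊥ y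
≤⊥-reflexive refl = ≤⊥-refl

≤⊥-antisym : ∀ {x y} → x ≤⊥ y → y ≤⊥ x → x ≡ y
≤⊥-antisym ⊥≤ ⊥≤ = refl
≤⊥-antisym (just≤ m≤n) (just≤ n≤m) = cong just (≤-antisym m≤n n≤m)

≤⊥-poset : Poset _ _ _
≤⊥-poset = record
  { _≤_ = _≤⊥_
  ; isPartialOrder = record
    { isPreorder = record
      { isEquivalence = isEquivalence
      ; reflexive = ≤⊥-reflexive
      ; trans = ≤⊥-trans
      }
    ; antisym = ≤⊥-antisym
    }
  }

_≤⊥?_ : ∀ x y → Dec (x ≤⊥ y)
nothing ≤⊥? y = yes ⊥≤
just m ≤⊥? nothing = no (λ ())
just m ≤⊥? just n with m ≤ℕ? n
... | yes m≤n = yes (just≤ m≤n)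
... | no m≰n = no (λ { (just≤ m≤n) → m≰n m≤n })

x≤x+⊥k : ∀ x k → x ≤⊥ (x +⊥ k)
x≤x+⊥k nothing k = ⊥≤
x≤x+⊥k (just m) k = just≤ (m≤m+n m k)

max⊥-ubˡ : ∀ x y → x ≤⊥ max⊥ x y
max⊥-ubˡ nothing y = ⊥≤
max⊥-ubˡ (just m) nothing = ≤⊥-refl
max⊥-ubˡ (just m) (just n) = just≤ (m≤m⊔n m n)

max⊥-ubʳ : ∀ x y → y ≤⊥ max⊥ x y
max⊥-ubʳ nothing y = ≤⊥-refl
max⊥-ubʳ (just m) nothing = ⊥≤
max⊥-ubʳ (just m) (just n) = just≤ (m≤n⊔m m n)

max⊥-lub : ∀ {x y z} → x ≤⊥ z → y ≤⊥ z → max⊥ x y ≤⊥ z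
max⊥-lub ⊥≤ y≤z = y≤z
max⊥-lub (just≤ m≤k) ⊥≤ = just≤ m≤k
max⊥-lub (just≤ m≤k) (just≤ n≤k) = just≤ (⊔-lub m≤k n≤k)

just≤⊥⇒just : ∀ {m y} → just m ≤⊥ y → ∃ λ n → y ≡ just n
just≤⊥⇒just (just≤ {n = n} _) = n , refl

open import Relation.Binary.Reasoning.PartialOrder ≤⊥-poset
  using (begin_; _∎; step-≤; step-≡-⟩; step-≡-⟨)

module _ {A : Set} (f : A → ℕ⊥) where

  maxOver-ub : ∀ xs {x} → x ∈ xs → f x ≤⊥ maxOver xs f
  maxOver-ub (y ∷ xs) (here refl) = max⊥-ubˡ (f y) _
  maxOver-ub (y ∷ xs) (there x∈xs) = ≤⊥-trans (maxOver-ub xs x∈xs) (max⊥-ubʳ (f y) _)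

  maxOver-lub : ∀ xs {z} → (∀ x → f x ≤⊥ z) → maxOver xs f ≤⊥ z
  maxOver-lub [] h = ⊥≤
  maxOver-lub (y ∷ xs) h = max⊥-lub (h y) (maxOver-lub xs h)

module NetProperties (N : Net) where
  open Net N

  enabled⇒marked : ∀ M {t p} → enabled N M t ≡ true → pre t p ≡ true → 1 ≤ M p
  enabled⇒marked M {t} {p} en pre-p
    with all-true⁻ (λ p → not (pre t p) ∨ (1 ≤ᵇ M p)) (places N) en (∈-allFin p)
  ... | marked rewrite pre-p = ≤ᵇ⇒≤ 1 (M p) (Equivalence.from T-≡ marked)

  marked⇒enabled : ∀ {M t} → (∀ p → pre t p ≡ true → 1 ≤ M p) → enabled N M t ≡ true
  marked⇒enabled {M} {t} marked = all-true⁺ _ (places N) check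
    where
    check : ∀ p → (not (pre t p) ∨ (1 ≤ᵇ M p)) ≡ true
    check p with pre t p in pre-p
    ... | true = Equivalence.to T-≡ (≤⇒≤ᵇ (marked p pre-p))
    ... | false = refl

  enabled-cong : ∀ {M M′} t → M ≗ M′ → enabled N M t ≡ enabled N M′ t
  enabled-cong t M≗M′ =
    all-cong _ _ (λ p → cong (λ k → not (pre t p) ∨ (1 ≤ᵇ k)) (M≗M′ p)) (places N)

  fire-cong : ∀ {M M′} t → M ≗ M′ → fire N M t ≗ fire N M′ t
  fire-cong t M≗M′ p rewrite M≗M′ p = refl

  fire-unconsumed-≤ : ∀ M t p → pre t p ≡ false → M p ≤ fire N M t p
  fire-unconsumed-≤ M t p pre-p rewrite pre-p = m≤m+n (M p) _

  disjoint⇒independent : ∀ {t u} → Disjoint (pre u) (pre t) → dependent N t u ≡ false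
  disjoint⇒independent {t} {u} d = any-false⁺ _ (places N) not-shared
    where
    not-shared : ∀ q → (pre t q ∧ pre u q) ≡ false
    not-shared q with pre u q in pre-u
    ... | false = ∧-zeroʳ (pre t q)
    ... | true rewrite d q pre-u = refl

  conflictSet⁻ : ∀ {u M v} → conflictSet N u M v ≡ true →
    enabled N M u ≡ true × enabled N M v ≡ true × dependent N u v ≡ true
  conflictSet⁻ {u} {M} h with ∧-true⁻ {enabled N M u} h
  ... | en-u , rest = en-u , ∧-true⁻ rest

  conflictSet⁺ : ∀ {u M v} → enabled N M u ≡ true → enabled N M v ≡ true →
    dependent N u v ≡ true → conflictSet N u M v ≡ true
  conflictSet⁺ en-u en-v dep = ∧-true⁺ en-u (∧-true⁺ en-v dep)

  conflictSet-cong : ∀ {M M′} u v → M ≗ M′ → conflictSet N u M v ≡ conflictSet N u M′ v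
  conflictSet-cong u v M≗M′ rewrite enabled-cong u M≗M′ | enabled-cong v M≗M′ = refl

  Fires-++⁻ : ∀ {M M₂} α β → Fires N M (α ++ β) M₂ →
    ∃ λ M₁ → Fires N M α M₁ × Fires N M₁ β M₂
  Fires-++⁻ [] β fβ = _ , done , fβ
  Fires-++⁻ (t ∷ α) β (step en f) with Fires-++⁻ α β f
  ... | M₁ , fα , fβ = M₁ , step en fα , fβ

  Fires-++⁺ : ∀ {M M₁ M₂} α β → Fires N M α M₁ → Fires N M₁ β M₂ →
    Fires N M (α ++ β) M₂
  Fires-++⁺ [] β done fβ = fβ
  Fires-++⁺ (t ∷ α) β (step en fα) fβ = step en (Fires-++⁺ α β fα fβ)

  Fires-resp-≗ : ∀ {M M′ M₂} β → M ≗ M′ → Fires N M β M₂ →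
    ∃ λ M₂′ → Fires N M′ β M₂′ × M₂ ≗ M₂′
  Fires-resp-≗ [] M≗M′ done = _ , done , M≗M′
  Fires-resp-≗ (t ∷ β) M≗M′ (step en f) with Fires-resp-≗ β (fire-cong t M≗M′) f
  ... | M₂′ , f′ , M₂≗M₂′ =
    M₂′ , step (trans (sym (enabled-cong t M≗M′)) en) f′ , M₂≗M₂′

  reachable-fire : ∀ {M t} → Reachable N M → enabled N M t ≡ true → Reachable N (fire N M t)
  reachable-fire (σ , f) en = σ ∷ʳ _ , Fires-++⁺ σ _ f (step en done)

  path-into-transition : ∀ {a t} → Star (ArcE N) a (inj₂ t) →
    a ≡ inj₂ t ⊎ ∃ λ q → pre t q ≡ true
  path-into-transition ε = inj₁ refl
  path-into-transition (arc ◅ path) with path-into-transition path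
  ... | inj₂ input = inj₂ input
  path-into-transition {inj₁ p} (arc ◅ path) | inj₁ refl = inj₂ (p , arc)
  path-into-transition {inj₂ u} (() ◅ path) | inj₁ refl

  preset-nonempty : IsWorkflowNet N → ∀ t → ∃ λ q → pre t q ≡ true
  preset-nonempty (_ , _ , connected) t with path-into-transition (connected (inj₁ iₚ) (inj₂ t))
  ... | inj₂ input = input

  removePre-marked⁻ : ∀ {M t p} → 1 ≤ removePre N M t p → pre t p ≡ false
  removePre-marked⁻ {M} {t} {p} marked with pre t p
  removePre-marked⁻ () | true
  removePre-marked⁻ _ | false = refl

  fire-at : ∀ M t p {a b} → pre t p ≡ a → post t p ≡ b → fire N M t p ≡ (M p ∸ b2n N a) + b2n N b
  fire-at M t p refl refl = refl

  record NonInterfering (w e : Trans N) : Set where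
    field
      pre-pre   : Disjoint (pre w) (pre e)
      pre-post  : Disjoint (pre w) (post e)
      post-pre  : Disjoint (post w) (pre e)
      post-post : Disjoint (post w) (post e)
  open NonInterfering public

  private
    shift-+0 : ∀ m a b → ((m ∸ a) + b) + 0 ≡ ((m + 0) ∸ a) + b
    shift-+0 m a b rewrite +-identityʳ ((m ∸ a) + b) | +-identityʳ m = refl

  fire-comm : ∀ {w e} → NonInterfering w e → ∀ M → fire N (fire N M w) e ≗ fire N (fire N M e) w
  fire-comm {w} {e} ni M q
    with pre w q in pw | post w q in qw | pre e q in pe | post e q in qe
  ... | true  | _     | true  | _     = ⊥-elim (disjoint-clash (pre-pre ni) pw pe)
  ... | true  | _     | false | true  = ⊥-elim (disjoint-clash (pre-post ni) pw qe)
  ... | _     | true  | true  | _     = ⊥-elim (disjoint-clash (post-pre ni) qw pe)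
  ... | true  | true  | false | false = shift-+0 (M q) 1 1
  ... | true  | false | false | false = shift-+0 (M q) 1 0
  ... | false | true  | false | true  = refl
  ... | false | true  | false | false = shift-+0 (M q) 0 1
  ... | false | false | false | true  = sym (shift-+0 (M q) 0 1)
  ... | false | false | false | false = refl
  ... | false | false | true  | true  = sym (shift-+0 (M q) 1 1)
  ... | false | false | true  | false = sym (shift-+0 (M q) 1 0)

module OneSafeProperties (N : Net) (safe : OneSafe N) where
  open Net N
  open NetProperties N

  still-marked : ∀ {M t q} → Reachable N M → post t q ≡ false → 1 ≤ fire N M t q →
    1 ≤ M q × pre t q ≡ false
  still-marked {M} {t} {q} r post-q marked =
    from-bits (M q) (pre t q) (safe M r q) (subst (1 ≤_) (fire-at M t q refl post-q) marked)
    where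
    from-bits : ∀ m a → m ≤ 1 → 1 ≤ (m ∸ b2n N a) + 0 → 1 ≤ m × a ≡ false
    from-bits zero false _ ()
    from-bits zero true _ ()
    from-bits (suc m) false _ _ = s≤s z≤n , refl
    from-bits (suc zero) true _ ()
    from-bits (suc (suc m)) true (s≤s ()) _

  marked-unconsumed⇒unproduced : ∀ {M t q} → Reachable N M → enabled N M t ≡ true →
    1 ≤ M q → pre t q ≡ false → post t q ≡ false
  marked-unconsumed⇒unproduced {M} {t} {q} r en marked pre-q = ¬-not produced
    where
    produced : ¬ post t q ≡ true
    produced post-q =
      <-irrefl refl (≤-trans (+-monoˡ-≤ 1 marked)
        (subst (_≤ 1) (fire-at M t q pre-q post-q) (safe _ (reachable-fire r en) q)))

  enabled-after-fire⁻ : ∀ {M t u} → Reachable N M → Disjoint (pre u) (post t) →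
    enabled N (fire N M t) u ≡ true → enabled N M u ≡ true × Disjoint (pre u) (pre t)
  enabled-after-fire⁻ {M} {t} {u} r d en =
    marked⇒enabled (λ q pre-q → proj₁ (kept q pre-q)) , (λ q pre-q → proj₂ (kept q pre-q))
    where
    kept : ∀ q → pre u q ≡ true → 1 ≤ M q × pre t q ≡ false
    kept q pre-q = still-marked r (d q pre-q) (enabled⇒marked (fire N M t) en pre-q)

  fire≗addPost-removePre : ∀ {M t} → Reachable N M → enabled N M t ≡ true →
    fire N M t ≗ addPost N (removePre N M t) t
  fire≗addPost-removePre {M} {t} r en p =
    from-bits (M p) (pre t p) (post t p) (safe M r p) (enabled⇒marked M en) (safe _ (reachable-fire r en) p)
    where
    from-bits : ∀ m a b → m ≤ 1 → (a ≡ true → 1 ≤ m) → (m ∸ b2n N a) + b2n N b ≤ 1 →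
      (m ∸ b2n N a) + b2n N b ≡ (if b then 1 else (if a then 0 else m))
    from-bits m false false _ _ _ = +-identityʳ m
    from-bits zero false true _ _ _ = refl
    from-bits (suc zero) false true _ _ (s≤s ())
    from-bits (suc (suc m)) _ _ (s≤s ()) _ _
    from-bits zero true _ _ marked _ with () ← marked refl
    from-bits (suc zero) true true _ _ _ = refl
    from-bits (suc zero) true false _ _ _ = refl

  swap-enabled : ∀ {M w e} → Reachable N M →
    enabled N M w ≡ true → enabled N (fire N M w) e ≡ true → Disjoint (post w) (pre e) →
    enabled N M e ≡ true × enabled N (fire N M e) w ≡ true × NonInterfering w e
  swap-enabled {M} {w} {e} r en-w en-e′ post-pre
    with enabled-after-fire⁻ r (Disjoint-sym post-pre) en-e′
  ... | en-e , pre-e-pre-w = en-e , en-w′ , record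
    { pre-pre = pre-w-pre-e
    ; pre-post = λ q pre-q →
        marked-unconsumed⇒unproduced r en-e (enabled⇒marked M en-w pre-q) (pre-w-pre-e q pre-q)
    ; post-pre = post-pre
    ; post-post = λ q post-q →
        marked-unconsumed⇒unproduced (reachable-fire r en-w) en-e′
          (subst (1 ≤_) (sym (fire-at M w q refl post-q)) (m≤n+m 1 _)) (post-pre q post-q)
    }
    where
    pre-w-pre-e : Disjoint (pre w) (pre e)
    pre-w-pre-e = Disjoint-sym pre-e-pre-w
    en-w′ : enabled N (fire N M e) w ≡ true
    en-w′ = marked⇒enabled (λ q pre-q →
      ≤-trans (enabled⇒marked M en-w pre-q) (fire-unconsumed-≤ M e q (pre-w-pre-e q pre-q)))

  conflict-after-concurrent-fire⁻ : ConfusionFree N → ∀ {M w u v} → Reachable N M →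
    enabled N M w ≡ true → enabled N M u ≡ true → dependent N w u ≡ false →
    conflictSet N u (fire N M w) v ≡ true → enabled N M v ≡ true × Disjoint (pre v) (pre w)
  conflict-after-concurrent-fire⁻ cf {M} {w} {u} {v} r en-w en-u indep conflict-after =
    proj₁ (proj₂ (conflictSet⁻ {u} {M} conflict-before)) ,
    λ p pre-p → removePre-marked⁻ {M} (enabled⇒marked (removePre N M w)
                  (proj₁ (proj₂ (conflictSet⁻ {u} {removePre N M w} conflict-removed))) pre-p)
    where
    conflict-before : conflictSet N u M v ≡ true
    conflict-before = trans (proj₂ (cf M r w u en-w en-u indep) v)
      (trans (sym (conflictSet-cong u v (fire≗addPost-removePre r en-w))) conflict-after)
    conflict-removed : conflictSet N u (removePre N M w) v ≡ true
    conflict-removed = trans (sym (proj₁ (cf M r w u en-w en-u indep) v)) conflict-before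

module TimingProperties (N : Net) (τ : Fin (Net.nt N) → ℕ) where
  open Net N
  open NetProperties N
  open Timing N τ

  finish : TimeVec → Trans N → ℕ⊥
  finish x t = maxPre x t +⊥ τ t

  maxPre-ub : ∀ x t {q} → pre t q ≡ true → x q ≤⊥ maxPre x t
  maxPre-ub x t {q} pre-q =
    subst (_≤⊥ maxPre x t) (cong (λ b → if b then x q else nothing) pre-q)
      (maxOver-ub (λ q → if pre t q then x q else nothing) (places N) (∈-allFin q))

  maxPre-lub : ∀ x t {z} → (∀ q → pre t q ≡ true → x q ≤⊥ z) → maxPre x t ≤⊥ z
  maxPre-lub x t {z} bound = maxOver-lub _ (places N) restricted
    where
    restricted : ∀ q → (if pre t q then x q else nothing) ≤⊥ z
    restricted q with pre t q in pre-q
    ... | true = bound q pre-q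
    ... | false = ⊥≤

  maxPre-mono : ∀ x y t → (∀ q → pre t q ≡ true → x q ≤⊥ y q) → maxPre x t ≤⊥ maxPre y t
  maxPre-mono x y t x≤y = maxPre-lub x t (λ q pre-q → ≤⊥-trans (x≤y q pre-q) (maxPre-ub y t pre-q))

  maxPre-cong : ∀ x y t → (∀ q → pre t q ≡ true → x q ≡ y q) → maxPre x t ≡ maxPre y t
  maxPre-cong x y t x≡y = ≤⊥-antisym
    (maxPre-mono x y t (λ q pre-q → ≤⊥-reflexive (x≡y q pre-q)))
    (maxPre-mono y x t (λ q pre-q → ≤⊥-reflexive (sym (x≡y q pre-q))))

  upd-produced : ∀ x t {p} → post t p ≡ true → upd x t p ≡ finish x t
  upd-produced x t post-p rewrite post-p = refl

  upd-consumed : ∀ x t {p} → post t p ≡ false → pre t p ≡ true → upd x t p ≡ nothing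
  upd-consumed x t post-p pre-p rewrite post-p | pre-p = refl

  upd-untouched : ∀ x t {p} → post t p ≡ false → pre t p ≡ false → upd x t p ≡ x p
  upd-untouched x t post-p pre-p rewrite post-p | pre-p = refl

  upd-cong : ∀ {x y} t → x ≗ y → upd x t ≗ upd y t
  upd-cong {x} {y} t x≗y p rewrite maxPre-cong x y t (λ q _ → x≗y q) | x≗y p = refl

  foldl-upd-cong : ∀ {x y} β → x ≗ y → foldl upd x β ≗ foldl upd y β
  foldl-upd-cong [] x≗y = x≗y
  foldl-upd-cong (t ∷ β) x≗y = foldl-upd-cong β (upd-cong t x≗y)

  maxPre-upd-untouched : ∀ x {t u} → Disjoint (pre u) (post t) → Disjoint (pre u) (pre t) →
    maxPre (upd x t) u ≡ maxPre x u
  maxPre-upd-untouched x {t} {u} unproduced unconsumed =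
    maxPre-cong _ _ u (λ q pre-q → upd-untouched x t (unproduced q pre-q) (unconsumed q pre-q))

  finish-upd-untouched : ∀ x {t u} → Disjoint (pre u) (post t) → Disjoint (pre u) (pre t) →
    finish (upd x t) u ≡ finish x u
  finish-upd-untouched x {u = u} unproduced unconsumed =
    cong (_+⊥ τ u) (maxPre-upd-untouched x unproduced unconsumed)

  upd-comm : ∀ {w e} → NonInterfering w e → ∀ x → upd (upd x w) e ≗ upd (upd x e) w
  upd-comm {w} {e} ni x q
    with post e q in qe | pre e q in pe | post w q in qw | pre w q in pw
  ... | true  | _     | true  | _     = ⊥-elim (disjoint-clash (post-post ni) qw qe)
  ... | true  | _     | false | true  = ⊥-elim (disjoint-clash (pre-post ni) pw qe)
  ... | true  | _     | false | false =
    cong (_+⊥ τ e) (maxPre-upd-untouched x (Disjoint-sym (post-pre ni)) (Disjoint-sym (pre-pre ni)))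
  ... | false | true  | true  | _     = ⊥-elim (disjoint-clash (post-pre ni) qw pe)
  ... | false | true  | false | true  = ⊥-elim (disjoint-clash (pre-pre ni) pw pe)
  ... | false | true  | false | false = refl
  ... | false | false | true  | _     =
    sym (cong (_+⊥ τ w) (maxPre-upd-untouched x (pre-post ni) (pre-pre ni)))
  ... | false | false | false | true  = refl
  ... | false | false | false | false = refl

  conflictValue-ub : ∀ ρ C {v p} → C v ≡ true → pre v p ≡ true → μ ρ p ≤⊥ conflictValue ρ C
  conflictValue-ub ρ C {v} {p} C-v pre-v =
    subst (_≤⊥ conflictValue ρ C)
      (cong (λ b → if b then μ ρ p else nothing)
        (any-true⁺ (λ v → C v ∧ pre v p) (allFinL nt) (∈-allFin v) (∧-true⁺ C-v pre-v)))
      (maxOver-ub (λ p → if any (λ v → C v ∧ pre v p) (allFinL nt) then μ ρ p else nothing)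
        (places N) (∈-allFin p))

  conflictValue-lub : ∀ ρ C {z} → (∀ p v → C v ≡ true → pre v p ≡ true → μ ρ p ≤⊥ z) →
    conflictValue ρ C ≤⊥ z
  conflictValue-lub ρ C {z} bound = maxOver-lub _ (places N) restricted
    where
    restricted : ∀ p → (if any (λ v → C v ∧ pre v p) (allFinL nt) then μ ρ p else nothing) ≤⊥ z
    restricted p with any (λ v → C v ∧ pre v p) (allFinL nt) in in-preset
    ... | true with any-true⁻ (λ v → C v ∧ pre v p) (allFinL nt) in-preset
    ...   | v , C-v∧pre-v = bound p v (proj₁ (∧-true⁻ C-v∧pre-v)) (proj₂ (∧-true⁻ C-v∧pre-v))
    restricted p | false = ⊥≤

  μ-∷ʳ : ∀ ρ t → μ (ρ ∷ʳ t) ≡ upd (μ ρ) t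
  μ-∷ʳ ρ t = foldl-∷ʳ upd μ0 t ρ

  start-∷ʳ : ∀ ρ t → start (ρ ∷ʳ t) ≡ maxPre (μ ρ) t
  start-∷ʳ ρ t rewrite unsnoc-∷ʳ ρ t = refl

  late-output-not-consumed : ∀ {B x w e} → ¬ finish x w ≤⊥ B → maxPre (upd x w) e ≤⊥ B →
    Disjoint (post w) (pre e)
  late-output-not-consumed {B} {x} {w} {e} late e-starts q post-q = ¬-not λ pre-q → late (begin
    finish x w          ≡⟨ upd-produced x w post-q ⟨
    upd x w q           ≤⟨ maxPre-ub _ e pre-q ⟩
    maxPre (upd x w) e  ≤⟨ e-starts ⟩
    B                   ∎)

  upd-bounded-or-unchanged : ∀ {B x e} → finish x e ≤⊥ B →
    ∀ p → upd x e p ≤⊥ B ⊎ upd x e p ≡ x p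
  upd-bounded-or-unchanged {B} {x} {e} e-finishes p with true-or-false (post e p) | true-or-false (pre e p)
  ... | inj₁ post-p | _ = inj₁ (subst (_≤⊥ B) (sym (upd-produced x e post-p)) e-finishes)
  ... | inj₂ post-p | inj₁ pre-p = inj₁ (subst (_≤⊥ B) (sym (upd-consumed x e post-p pre-p)) ⊥≤)
  ... | inj₂ post-p | inj₂ pre-p = inj₂ (upd-untouched x e post-p pre-p)

module EarliestFirst (W : TPWN) where
  open TPWN W
  open Net net
  open Timing net τ
  open NetProperties net
  open OneSafeProperties net oneSafe
  open TimingProperties net τ

  Timed : Marking net → TimeVec → Set
  Timed M x = ∀ q → 1 ≤ M q → ∃ λ k → x q ≡ just k

  Timed-init : Timed (initM net) μ0
  Timed-init q marked with q ≟ᶠ iₚ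
  Timed-init q marked | yes _ = 0 , refl
  Timed-init q () | no _

  Timed-fire : ∀ {M x t} → Reachable net M → enabled net M t ≡ true → Timed M x →
    Timed (fire net M t) (upd x t)
  Timed-fire {M} {x} {t} r en timed q marked with true-or-false (post t q)
  ... | inj₁ post-q with preset-nonempty isWF t
  ...   | q₀ , pre-q₀ with timed q₀ (enabled⇒marked M en pre-q₀)
  ...     | k , x-q₀ with just≤⊥⇒just (subst (_≤⊥ maxPre x t) x-q₀ (maxPre-ub x t pre-q₀))
  ...       | n , maxPre≡ = n + τ t , trans (upd-produced x t post-q) (cong (_+⊥ τ t) maxPre≡)
  Timed-fire {M} {x} {t} r en timed q marked | inj₂ post-q with still-marked r post-q marked
  ... | marked-before , pre-q =
    subst (λ z → ∃ λ k → z ≡ just k) (sym (upd-untouched x t post-q pre-q)) (timed q marked-before)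

  Timed-run : ∀ {M M′ x} β → Reachable net M → Fires net M β M′ → Timed M x →
    Timed M′ (foldl upd x β)
  Timed-run [] r done timed = timed
  Timed-run (t ∷ β) r (step en f) timed = Timed-run β (reachable-fire r en) f (Timed-fire r en timed)

  maxPre-enabled-defined : ∀ {σ M u} → Fires net (initM net) σ M → enabled net M u ≡ true →
    ∃ λ k → maxPre (μ σ) u ≡ just k
  maxPre-enabled-defined {σ} {M} {u} f en with preset-nonempty isWF u
  ... | q , pre-q with Timed-run σ ([] , done) f Timed-init q (enabled⇒marked M en pre-q)
  ...   | k , μ-q = just≤⊥⇒just (subst (_≤⊥ maxPre (μ σ) u) μ-q (maxPre-ub (μ σ) u pre-q))

  μ0-≤-just : ∀ p k → μ0 p ≤⊥ just k
  μ0-≤-just p k with p ≟ᶠ iₚ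
  ... | yes _ = just≤ z≤n
  ... | no _ = ⊥≤

  data FinishBy (B : ℕ⊥) : TimeVec → List (Trans net) → Set where
    [] : ∀ {x} → FinishBy B x []
    _∷_ : ∀ {x e β} → finish x e ≤⊥ B → FinishBy B (upd x e) β → FinishBy B x (e ∷ β)

  FinishBy-resp-≗ : ∀ {B x y} β → x ≗ y → FinishBy B x β → FinishBy B y β
  FinishBy-resp-≗ [] _ [] = []
  FinishBy-resp-≗ {B} {x} {y} (e ∷ β) x≗y (e-finishes ∷ rest) =
    subst (_≤⊥ B) (cong (_+⊥ τ e) (maxPre-cong x y e (λ q _ → x≗y q))) e-finishes
      ∷ FinishBy-resp-≗ β (upd-cong e x≗y) rest

  FinishBy⇒bounded-or-unchanged : ∀ {B x} β → FinishBy B x β →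
    ∀ p → foldl upd x β p ≤⊥ B ⊎ foldl upd x β p ≡ x p
  FinishBy⇒bounded-or-unchanged [] [] p = inj₂ refl
  FinishBy⇒bounded-or-unchanged {B} (e ∷ β) (e-finishes ∷ rest) p
    with FinishBy⇒bounded-or-unchanged β rest p | upd-bounded-or-unchanged e-finishes p
  ... | inj₁ bounded | _ = inj₁ bounded
  ... | inj₂ unchanged | inj₁ bounded = inj₁ (subst (_≤⊥ B) (sym unchanged) bounded)
  ... | inj₂ unchanged | inj₂ unchanged′ = inj₂ (trans unchanged unchanged′)

  split-at-last-late : ∀ B x σ → FinishBy B x σ ⊎
    ∃₂ λ α w → ∃ λ β → σ ≡ α ++ w ∷ β
      × ¬ finish (foldl upd x α) w ≤⊥ B × FinishBy B (upd (foldl upd x α) w) β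
  split-at-last-late B x [] = inj₁ []
  split-at-last-late B x (e ∷ σ) with split-at-last-late B (upd x e) σ
  ... | inj₂ (α , w , β , σ≡ , late , rest) = inj₂ (e ∷ α , w , β , cong (e ∷_) σ≡ , late , rest)
  ... | inj₁ rest with finish x e ≤⊥? B
  ...   | yes e-finishes = inj₁ (e-finishes ∷ rest)
  ...   | no late = inj₂ ([] , e , σ , refl , late , rest)

  postpone : ∀ {B} β {M M₂ x w} → Reachable net M → enabled net M w ≡ true →
    ¬ finish x w ≤⊥ B → FinishBy B (upd x w) β → Fires net (fire net M w) β M₂ →
    ∃ λ M₁ → Fires net M β M₁ × enabled net M₁ w ≡ true × fire net M₁ w ≗ M₂
           × upd (foldl upd x β) w ≗ foldl upd (upd x w) β × finish (foldl upd x β) w ≡ finish x w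
  postpone [] r en-w late [] done = _ , done , en-w , (λ _ → refl) , (λ _ → refl) , refl
  postpone {B} (e ∷ β) {M} {x = x} {w} r en-w late (e-finishes ∷ rest) (step en-e′ f)
    with swap-enabled r en-w en-e′
           (late-output-not-consumed late (≤⊥-trans (x≤x+⊥k _ (τ e)) e-finishes))
  ... | en-e , en-w′ , ni with Fires-resp-≗ β (fire-comm ni M) f
  ... | M₂′ , f′ , M₂≗M₂′
    with postpone β (reachable-fire r en-e) en-w′
           (late ∘ subst (_≤⊥ B) (finish-upd-untouched x (pre-post ni) (pre-pre ni)))
           (FinishBy-resp-≗ β (upd-comm ni x) rest) f′
  ... | M₁ , f₁ , en-w₁ , fire≗ , upd≗ , finish≡ =
    M₁ , step en-e f₁ , en-w₁ , (λ p → trans (fire≗ p) (sym (M₂≗M₂′ p))) ,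
    (λ p → trans (upd≗ p) (foldl-upd-cong β (λ q → sym (upd-comm ni x q)) p)) ,
    trans finish≡ (finish-upd-untouched x (pre-post ni) (pre-pre ni))

  postpone-late : ∀ {B} α w β {M} → Fires net (initM net) (α ++ w ∷ β) M →
    ¬ finish (μ α) w ≤⊥ B → FinishBy B (upd (μ α) w) β →
    ∃ λ M′ → Fires net (initM net) (α ++ β) M′ × enabled net M′ w ≡ true × fire net M′ w ≗ M
           × upd (μ (α ++ β)) w ≗ μ (α ++ w ∷ β) × ¬ finish (μ (α ++ β)) w ≤⊥ B
  postpone-late {B} α w β f late rest
    rewrite foldl-++ upd μ0 α β | foldl-++ upd μ0 α (w ∷ β)
    with Fires-++⁻ α (w ∷ β) f
  ... | Mα , fα , step en-w fβ with postpone β (α , fα) en-w late rest fβ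
  ... | M′ , fβ′ , en-w′ , fire≗ , upd≗ , finish≡ =
    M′ , Fires-++⁺ α β fα fβ′ , en-w′ , fire≗ , upd≗ , late ∘ subst (_≤⊥ B) finish≡

  conflict-input-time-≤ : ∀ σ {M u v p} → Fires net (initM net) σ M →
    enabled net M u ≡ true → enabled net M v ≡ true → dependent net u v ≡ true → pre v p ≡ true →
    μ σ p ≤⊥ maxPre (μ σ) u
  conflict-input-time-≤ σ = by-length (suc (length σ)) σ ≤-refl
    where
    by-length : ∀ n σ {M u v p} → length σ < n → Fires net (initM net) σ M →
      enabled net M u ≡ true → enabled net M v ≡ true → dependent net u v ≡ true → pre v p ≡ true →
      μ σ p ≤⊥ maxPre (μ σ) u
    by-length (suc n) σ {M} {u} {v} {p} (s≤s σ≤n) f en-u en-v dep pre-v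
      with split-at-last-late (maxPre (μ σ) u) μ0 σ
    ... | inj₁ all-finish with FinishBy⇒bounded-or-unchanged σ all-finish p
    ...   | inj₁ bounded = bounded
    ...   | inj₂ initial with maxPre-enabled-defined f en-u
    ...     | k , B≡ = subst₂ _≤⊥_ (sym initial) (sym B≡) (μ0-≤-just p k)
    by-length (suc n) σ {M} {u} {v} {p} (s≤s σ≤n) f en-u en-v dep pre-v
      | inj₂ (α , w , β , refl , late , rest) with postpone-late α w β f late rest
    ... | M′ , f′ , en-w , fire≗ , upd≗ , late′ = begin
      μ (α ++ w ∷ β) p               ≡⟨ upd≗ p ⟨
      upd (μ (α ++ β)) w p           ≡⟨ upd-untouched (μ (α ++ β)) w p-unproduced p-unconsumed ⟩
      μ (α ++ β) p                   ≤⟨ by-length n (α ++ β) shorter f′ en-u′ en-v′ dep pre-v ⟩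
      maxPre (μ (α ++ β)) u          ≡⟨ maxPre-upd-untouched (μ (α ++ β)) u-unproduced u-unconsumed ⟨
      maxPre (upd (μ (α ++ β)) w) u  ≡⟨ maxPre-cong _ _ u (λ q _ → upd≗ q) ⟩
      maxPre (μ (α ++ w ∷ β)) u      ∎
      where
      shorter : length (α ++ β) < n
      shorter = subst (_≤ n) (length-++-sucʳ α w β) σ≤n
      u-unproduced : Disjoint (pre u) (post w)
      u-unproduced = Disjoint-sym (late-output-not-consumed late′
        (≤⊥-reflexive (maxPre-cong _ _ u (λ q _ → upd≗ q))))
      reachable′ : Reachable net M′
      reachable′ = _ , f′
      en-u-after : enabled net (fire net M′ w) u ≡ true
      en-u-after = trans (enabled-cong u fire≗) en-u
      u-before : enabled net M′ u ≡ true × Disjoint (pre u) (pre w)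
      u-before = enabled-after-fire⁻ reachable′ u-unproduced en-u-after
      en-u′ : enabled net M′ u ≡ true
      en-u′ = proj₁ u-before
      u-unconsumed : Disjoint (pre u) (pre w)
      u-unconsumed = proj₂ u-before
      v-before : enabled net M′ v ≡ true × Disjoint (pre v) (pre w)
      v-before = conflict-after-concurrent-fire⁻ confFree reachable′ en-w en-u′
        (disjoint⇒independent u-unconsumed)
        (conflictSet⁺ {M = fire net M′ w} en-u-after (trans (enabled-cong v fire≗) en-v) dep)
      en-v′ : enabled net M′ v ≡ true
      en-v′ = proj₁ v-before
      p-unconsumed : pre w p ≡ false
      p-unconsumed = proj₂ v-before p pre-v
      p-unproduced : post w p ≡ false
      p-unproduced =
        marked-unconsumed⇒unproduced reachable′ en-w (enabled⇒marked M′ en-v′ pre-v) p-unconsumed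

  earliest-first-step : ∀ {γ} → IsEarliestFirst γ → ∀ ρ t u rest {M} →
    Fires net (initM net) (ρ ++ t ∷ u ∷ rest) M → Compatible γ (ρ ++ t ∷ u ∷ rest) →
    start (ρ ∷ʳ t) ≤⊥ start (ρ ∷ʳ t ∷ʳ u)
  earliest-first-step earliest ρ t u rest f compatible
    rewrite start-∷ʳ (ρ ∷ʳ t) u | start-∷ʳ ρ t | μ-∷ʳ ρ t
    with Fires-++⁻ ρ (t ∷ u ∷ rest) f
  ... | Mρ , fρ , step en-t (step en-u-after _) with disjoint-or-overlap (pre u) (post t)
  ... | inj₂ (q , pre-q , post-q) = begin
    maxPre (μ ρ) t          ≤⟨ x≤x+⊥k _ (τ t) ⟩
    finish (μ ρ) t          ≡⟨ upd-produced (μ ρ) t post-q ⟨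
    upd (μ ρ) t q           ≤⟨ maxPre-ub _ u pre-q ⟩
    maxPre (upd (μ ρ) t) u  ∎
  ... | inj₁ u-unproduced with enabled-after-fire⁻ (ρ , fρ) u-unproduced en-u-after
  ... | en-u , u-unconsumed with earliest ρ Mρ fρ (t , en-t)
  ... | t₀ , _ , γ≐ , minimal = begin
    maxPre (μ ρ) t                           ≤⟨ maxPre-lub _ t (λ _ → conflictValue-ub ρ _ t-chosen) ⟩
    conflictValue ρ (conflictSet net t₀ Mρ)  ≤⟨ minimal u en-u ⟩
    conflictValue ρ (conflictSet net u Mρ)   ≤⟨ conflictValue-lub ρ _ conflict-inputs-≤ ⟩
    maxPre (μ ρ) u                           ≡⟨ maxPre-upd-untouched (μ ρ) u-unproduced u-unconsumed ⟨
    maxPre (upd (μ ρ) t) u                   ∎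
    where
    t-chosen : conflictSet net t₀ Mρ t ≡ true
    t-chosen = trans (sym (γ≐ t)) (compatible ρ t (u ∷ rest) refl)
    conflict-inputs-≤ : ∀ p v → conflictSet net u Mρ v ≡ true → pre v p ≡ true →
      μ ρ p ≤⊥ maxPre (μ ρ) u
    conflict-inputs-≤ p v conflict pre-v with conflictSet⁻ {u} {Mρ} conflict
    ... | _ , en-v , dep = conflict-input-time-≤ ρ fρ en-u en-v dep pre-v

lemma8 : (W : TPWN) →
    let open TPWN W in
    let open Timing net τ in
    (γ : List (Fin (Net.nt net)) → TSet net) → IsEarliestFirst γ →
    (σ : List (Fin (Net.nt net))) → ∃ (Fires net (initM net) σ) → Compatible γ σ →
    ∀ i → 1 ≤ i → i < length σ →
      start (take i σ) ≤⊥ start (take (suc i) σ)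
lemma8 W γ earliest σ (M , f) compatible (suc k) _ k+1<σ with take-consecutive k σ k+1<σ
... | ρ , t , u , rest , refl , take₁ , take₂
  rewrite take₁ | take₂ = EarliestFirst.earliest-first-step W earliest ρ t u rest f compatible
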